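{- Define $f:\mathbb{R}\to\mathbb{R}$ by $f(t)=t^2$ for $t\ge0$ and $f(t)=-t^2$ for $t<0$, and let $D=\{(t,f(t)):t\in\mathbb{R}\}\subseteq\mathbb{R}^2$. Then for any two distinct points $P,Q\in\mathbb{R}^2$ there are at most $2$ vectors $v\in\mathbb{R}^2$ with $P,Q\in D+v$. The same holds with $D$ replaced by $-D$.
   Context: $D$ is the union of the left half of the downward parabola $y=-x^2$ and the right half of the upward parabola $y=x^2$, including the origin. -}

module Defs where

open import Level using (0ℓ)
open import Data.Product using (Σ; _×_; _,_; proj₁; proj₂)
open import Data.Sum using (_⊎_)
open import Relation.Nullary using (¬_)
open import Relation.Binary.PropositionalEquality using (_≡_)
open import Relation.Binary.Definitions using (Tri; tri<; tri≈; tri>)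
open import Relation.Binary.Structures using (IsStrictTotalOrder)
open import Algebra.Structures using (IsCommutativeRing)

-- The real numbers, given axiomatically as a complete ordered field
-- (Dedekind-complete, with classical trichotomy). agda-stdlib has no reals.
record Reals : Set₁ where
  infixl 6 _+_
  infixl 7 _*_
  infix 8 -_
  infix 4 _<_ _≤_
  field
    ℝ   : Set
    _+_ : ℝ → ℝ → ℝ
    _*_ : ℝ → ℝ → ℝ
    -_  : ℝ → ℝ
    0# : ℝ
    1# : ℝ
    isCommutativeRing : IsCommutativeRing _≡_ _+_ _*_ -_ 0# 1#
    0≢1 : ¬ (0# ≡ 1#)
    inverse : ∀ x → ¬ (x ≡ 0#) → Σ ℝ (λ y → x * y ≡ 1#)
    _<_ : ℝ → ℝ → Set
    isStrictTotalOrder : IsStrictTotalOrder _≡_ _<_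
    +-mono-< : ∀ {x y} z → x < y → x + z < y + z
    *-pos : ∀ {x y} → 0# < x → 0# < y → 0# < x * y

  _≤_ : ℝ → ℝ → Set
  x ≤ y = (x < y) ⊎ (x ≡ y)

  IsUpperBound : (ℝ → Set) → ℝ → Set
  IsUpperBound S b = ∀ x → S x → x ≤ b

  field
    complete : (S : ℝ → Set) → Σ ℝ S → Σ ℝ (IsUpperBound S) →
               Σ ℝ (λ s → IsUpperBound S s × (∀ b → IsUpperBound S b → s ≤ b))

  open IsStrictTotalOrder isStrictTotalOrder public using (compare)

module RealDefs (R : Reals) where
  open Reals R

  Point : Set
  Point = ℝ × ℝ

  _⊕_ : Point → Point → Point
  (a , b) ⊕ (c , d) = (a + c , b + d)

  ⊖_ : Point → Point
  ⊖ (a , b) = (- a , - b)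

  _-ᵖ_ : Point → Point → Point
  p -ᵖ q = p ⊕ (⊖ q)

  f : ℝ → ℝ
  f t with compare t 0#
  ... | tri< _ _ _ = - (t * t)
  ... | tri≈ _ _ _ = t * t
  ... | tri> _ _ _ = t * t

  D : Point → Set
  D (x , y) = Σ ℝ (λ t → (x , y) ≡ (t , f t))

  negD : Point → Set
  negD p = Σ Point (λ q → D q × p ≡ ⊖ q)

  Translate : (Point → Set) → Point → Point → Set
  Translate S v p = Σ Point (λ q → S q × p ≡ q ⊕ v)

  AtMostTwo : (Point → Set) → Set
  AtMostTwo P = ∀ u v w → P u → P v → P w → (u ≡ v) ⊎ (u ≡ w) ⊎ (v ≡ w)

module Submission where

open import Defs
open import Level using (0ℓ)
open import Data.Empty using (⊥-elim)
open import Data.Integer.Base as ℤ using (ℤ; +_; -[1+_]; _⊖_; _◃_)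
import Data.Integer.Properties as ℤ
open import Data.Maybe.Base using (Maybe; just; nothing)
open import Data.Nat.Base as ℕ using (ℕ; zero; suc)
import Data.Nat.Properties as ℕₚ
open import Data.Product.Base as Product using (Σ; _×_; _,_; proj₁; proj₂; swap)
open import Data.Sign.Base as Sign using ()
open import Data.Sum.Base as Sum using (_⊎_; inj₁; inj₂)
open import Relation.Nullary using (¬_; yes; no)
open import Relation.Binary.Definitions using (tri<; tri≈; tri>)
open import Relation.Binary.Structures using (IsStrictTotalOrder)
open import Relation.Binary.PropositionalEquality
  using (_≡_; refl; sym; trans; cong; cong₂; subst; subst₂; module ≡-Reasoning)
import Relation.Binary.PropositionalEquality as ≡
open import Algebra.Bundles using (CommutativeRing)
import Algebra.Solver.Ring as RingSolver
open import Algebra.Solver.Ring.AlmostCommutativeRing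
  using (fromCommutativeRing; _-Raw-AlmostCommutative⟶_)

-- Write d = p₁ - q₁ and c = p₂ - q₂. A translate v carrying D through Q and P is
-- determined by the abscissa s of Q - v, and it exists iff Δ d s = c, where Δ d s = f (s + d) - f s.
-- We may assume d > 0 (swap P and Q; for d = 0 the graph D meets a vertical line once, so P = Q).
-- On each of the three ranges s + d ≤ 0, s < 0 < s + d and 0 ≤ s, the function Δ d is a polynomial
-- in s, and comparing these polynomials shows that Δ d s = Δ d u forces s = u or s + u + d = 0:
-- Δ d is symmetric about -d/2 and injective on either side of it. Three solutions of Δ d s = c
-- therefore cannot be pairwise distinct. Finally -D = D because f is odd.

-- Tactic.RingSolver does not recognise the record projections of Reals as ring operations, and
-- ℝ has no computable equality, so Algebra.Solver.Ring is run with integer coefficients.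
module IntegerCoefficients {c ℓ} (R : CommutativeRing c ℓ) where
  open CommutativeRing R renaming (refl to ≈-refl; sym to ≈-sym; trans to ≈-trans)
  open import Algebra.Properties.Ring ring
    using (-0#≈0#; -‿involutive; -‿+-comm; -‿distribˡ-*; -‿distribʳ-*)
  open import Algebra.Properties.CommutativeSemigroup +-commutativeSemigroup
    using (interchange)
  open import Algebra.Properties.Semiring.Mult semiring using (×-homo-+; ×1-homo-*) renaming (_×_ to _·_)
  open import Relation.Binary.Reasoning.Setoid setoid

  fromℕ : ℕ → Carrier
  fromℕ n = n · 1#

  fromℤ : ℤ → Carrier
  fromℤ (+ n)    = fromℕ n
  fromℤ -[1+ n ] = - fromℕ (suc n)

  -x*-y≈x*y : ∀ x y → - x * - y ≈ x * y
  -x*-y≈x*y x y = begin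
    - x * - y    ≈⟨ -‿distribˡ-* x (- y) ⟨
    - (x * - y)  ≈⟨ -‿cong (-‿distribʳ-* x y) ⟨
    - - (x * y)  ≈⟨ -‿involutive (x * y) ⟩
    x * y        ∎

  x+y-[x+z]≈y-z : ∀ x y z → (x + y) - (x + z) ≈ y - z
  x+y-[x+z]≈y-z x y z = begin
    (x + y) - (x + z)     ≈⟨ +-congˡ (-‿+-comm x z) ⟨
    (x + y) + (- x - z)   ≈⟨ interchange x y (- x) (- z) ⟩
    (x - x) + (y - z)     ≈⟨ +-congʳ (-‿inverseʳ x) ⟩
    0# + (y - z)          ≈⟨ +-identityˡ (y - z) ⟩
    y - z                 ∎

  fromℤ-⊖ : ∀ m n → fromℤ (m ⊖ n) ≈ fromℕ m - fromℕ n
  fromℤ-⊖ m       zero    = ≈-sym (≈-trans (+-congˡ -0#≈0#) (+-identityʳ (fromℕ m)))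
  fromℤ-⊖ zero    (suc n) = ≈-sym (+-identityˡ _)
  fromℤ-⊖ (suc m) (suc n) = begin
    fromℤ (suc m ⊖ suc n)                   ≡⟨ ≡.cong fromℤ (ℤ.[1+m]⊖[1+n]≡m⊖n m n) ⟩
    fromℤ (m ⊖ n)                           ≈⟨ fromℤ-⊖ m n ⟩
    fromℕ m - fromℕ n                       ≈⟨ x+y-[x+z]≈y-z 1# (fromℕ m) (fromℕ n) ⟨
    fromℕ (suc m) - fromℕ (suc n)           ∎

  fromℤ-+ : ∀ i j → fromℤ (i ℤ.+ j) ≈ fromℤ i + fromℤ j
  fromℤ-+ (+ m)    (+ n)    = ×-homo-+ 1# m n
  fromℤ-+ (+ m)    -[1+ n ] = fromℤ-⊖ m (suc n)
  fromℤ-+ -[1+ m ] (+ n)    = ≈-trans (fromℤ-⊖ n (suc m)) (+-comm _ _)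
  fromℤ-+ -[1+ m ] -[1+ n ] = begin
    - fromℕ (suc (suc m ℕ.+ n))          ≡⟨ ≡.cong (λ k → - fromℕ k) (ℕₚ.+-suc (suc m) n) ⟨
    - fromℕ (suc m ℕ.+ suc n)            ≈⟨ -‿cong (×-homo-+ 1# (suc m) (suc n)) ⟩
    - (fromℕ (suc m) + fromℕ (suc n))    ≈⟨ -‿+-comm _ _ ⟨
    - fromℕ (suc m) + - fromℕ (suc n)    ∎

  fromℤ-+◃ : ∀ n → fromℤ (Sign.+ ◃ n) ≈ fromℕ n
  fromℤ-+◃ zero    = ≈-refl
  fromℤ-+◃ (suc n) = ≈-refl

  fromℤ--◃ : ∀ n → fromℤ (Sign.- ◃ n) ≈ - fromℕ n
  fromℤ--◃ zero    = ≈-sym -0#≈0#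
  fromℤ--◃ (suc n) = ≈-refl

  fromℤ-* : ∀ i j → fromℤ (i ℤ.* j) ≈ fromℤ i * fromℤ j
  fromℤ-* (+ m)    (+ n)    = ≈-trans (fromℤ-+◃ (m ℕ.* n)) (×1-homo-* m n)
  fromℤ-* (+ m)    -[1+ n ] =
    ≈-trans (fromℤ--◃ (m ℕ.* suc n)) (≈-trans (-‿cong (×1-homo-* m (suc n))) (-‿distribʳ-* _ _))
  fromℤ-* -[1+ m ] (+ n)    =
    ≈-trans (fromℤ--◃ (suc m ℕ.* n)) (≈-trans (-‿cong (×1-homo-* (suc m) n)) (-‿distribˡ-* _ _))
  fromℤ-* -[1+ m ] -[1+ n ] =
    ≈-trans (×1-homo-* (suc m) (suc n)) (≈-sym (-x*-y≈x*y (fromℕ (suc m)) (fromℕ (suc n))))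

  fromℤ-- : ∀ i → fromℤ (ℤ.- i) ≈ - fromℤ i
  fromℤ-- (+ zero)  = ≈-sym -0#≈0#
  fromℤ-- (+ suc n) = ≈-refl
  fromℤ-- -[1+ n ]  = ≈-sym (-‿involutive _)

  fromℤ-morphism : ℤ.+-*-rawRing -Raw-AlmostCommutative⟶ fromCommutativeRing R
  fromℤ-morphism = record
    { ⟦_⟧    = fromℤ
    ; +-homo = fromℤ-+
    ; *-homo = fromℤ-*
    ; -‿homo = fromℤ--
    ; 0-homo = ≈-refl
    ; 1-homo = +-identityʳ 1#
    }

  fromℤ-≟ : ∀ i j → Maybe (fromℤ i ≈ fromℤ j)
  fromℤ-≟ i j with i ℤ.≟ j
  ... | yes ≡.refl = just ≈-refl
  ... | no _       = nothing

  open RingSolver ℤ.+-*-rawRing (fromCommutativeRing R) fromℤ-morphism fromℤ-≟ public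

module TranslatesOfD (ℛ : Reals) where
  open Reals ℛ
  open RealDefs ℛ

  ℝ-commutativeRing : CommutativeRing 0ℓ 0ℓ
  ℝ-commutativeRing = record { isCommutativeRing = isCommutativeRing }

  open CommutativeRing ℝ-commutativeRing
    using (_-_; +-comm; +-identityˡ; *-identityˡ; distribʳ; zeroˡ; -‿inverseʳ)
  open import Algebra.Properties.Ring (CommutativeRing.ring ℝ-commutativeRing)
    using (-0#≈0#; -‿injective; +-cancelˡ; +-cancelʳ; x∙y⁻¹≈ε⇒x≈y; x≈y⇒x∙y⁻¹≈ε)
  open IntegerCoefficients ℝ-commutativeRing using (solve; _:+_; _:*_; :-_; _:-_; _:=_)
  open IsStrictTotalOrder isStrictTotalOrder using () renaming (irrefl to <-irrefl; trans to <-trans)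
  open ≡-Reasoning

  x-y≡0⇒x≡y : ∀ {x y} → x - y ≡ 0# → x ≡ y
  x-y≡0⇒x≡y = x∙y⁻¹≈ε⇒x≈y _ _

  x≡y⇒x-y≡0 : ∀ {x y} → x ≡ y → x - y ≡ 0#
  x≡y⇒x-y≡0 = x≈y⇒x∙y⁻¹≈ε

  <0⊎0≤ : ∀ t → t < 0# ⊎ 0# ≤ t
  <0⊎0≤ t with compare t 0#
  ... | tri< t<0 _ _ = inj₁ t<0
  ... | tri≈ _ t≡0 _ = inj₂ (inj₂ (sym t≡0))
  ... | tri> _ _ 0<t = inj₂ (inj₁ 0<t)

  x<y⇒0<y-x : ∀ {x y} → x < y → 0# < y - x
  x<y⇒0<y-x {x} {y} x<y = subst (_< y - x) (-‿inverseʳ x) (+-mono-< (- x) x<y)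

  x<0⇒0<-x : ∀ {x} → x < 0# → 0# < - x
  x<0⇒0<-x x<0 = subst (0# <_) (+-identityˡ _) (x<y⇒0<y-x x<0)

  x≤0⇒0≤-x : ∀ {x} → x ≤ 0# → 0# ≤ - x
  x≤0⇒0≤-x (inj₁ x<0) = inj₁ (x<0⇒0<-x x<0)
  x≤0⇒0≤-x (inj₂ refl) = inj₂ (sym -0#≈0#)

  0≤x⇒-x≤0 : ∀ {x} → 0# ≤ x → - x ≤ 0#
  0≤x⇒-x≤0 {x} (inj₁ 0<x) =
    inj₁ (subst₂ _<_ (+-identityˡ (- x)) (-‿inverseʳ x) (+-mono-< (- x) 0<x))
  0≤x⇒-x≤0 (inj₂ refl)    = inj₂ -0#≈0#

  0<x⇒x≢0 : ∀ {x} → 0# < x → ¬ x ≡ 0#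
  0<x⇒x≢0 0<x refl = <-irrefl refl 0<x

  +-nonneg-pos : ∀ {x y} → 0# ≤ x → 0# < y → 0# < x + y
  +-nonneg-pos {x} {y} (inj₁ 0<x) 0<y = <-trans 0<y (subst (_< x + y) (+-identityˡ y) (+-mono-< y 0<x))
  +-nonneg-pos (inj₂ refl) 0<y        = subst (0# <_) (sym (+-identityˡ _)) 0<y

  *-nonneg-pos : ∀ {x y} → 0# ≤ x → 0# < y → 0# ≤ x * y
  *-nonneg-pos (inj₁ 0<x) 0<y = inj₁ (*-pos 0<x 0<y)
  *-nonneg-pos (inj₂ refl) _  = inj₂ (sym (zeroˡ _))

  0<1 : 0# < 1#
  0<1 with compare 1# 0#
  ... | tri> _ _ 0<1 = 0<1
  ... | tri≈ _ 1≡0 _ = ⊥-elim (0≢1 (sym 1≡0))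
  ... | tri< 1<0 _ _ =
    ⊥-elim (<-irrefl refl (<-trans 1<0 (subst (0# <_) [-1][-1]≡1 (*-pos 0<-1 0<-1))))
    where
    0<-1 : 0# < - 1#
    0<-1 = x<0⇒0<-x 1<0
    [-1][-1]≡1 : - 1# * - 1# ≡ 1#
    [-1][-1]≡1 = trans (solve 1 (λ x → :- x :* :- x := x :* x) refl 1#) (*-identityˡ 1#)

  x≢0⇒x*y≡0⇒y≡0 : ∀ {x y} → ¬ x ≡ 0# → x * y ≡ 0# → y ≡ 0#
  x≢0⇒x*y≡0⇒y≡0 {x} {y} x≢0 xy≡0 with inverse x x≢0
  ... | x⁻¹ , xx⁻¹≡1 = begin
    y               ≡⟨ *-identityˡ y ⟨
    1# * y          ≡⟨ cong (_* y) xx⁻¹≡1 ⟨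
    x * x⁻¹ * y     ≡⟨ solve 3 (λ x x⁻¹ y → x :* x⁻¹ :* y := x :* y :* x⁻¹) refl x x⁻¹ y ⟩
    x * y * x⁻¹     ≡⟨ cong (_* x⁻¹) xy≡0 ⟩
    0# * x⁻¹        ≡⟨ zeroˡ x⁻¹ ⟩
    0#              ∎

  x*y≡0⇒x≡0⊎y≡0 : ∀ {x y} → x * y ≡ 0# → x ≡ 0# ⊎ y ≡ 0#
  x*y≡0⇒x≡0⊎y≡0 {x} xy≡0 with compare x 0#
  ... | tri≈ _ x≡0 _ = inj₁ x≡0
  ... | tri< _ x≢0 _ = inj₂ (x≢0⇒x*y≡0⇒y≡0 x≢0 xy≡0)
  ... | tri> _ x≢0 _ = inj₂ (x≢0⇒x*y≡0⇒y≡0 x≢0 xy≡0)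

  x+x≡0⇒x≡0 : ∀ {x} → x + x ≡ 0# → x ≡ 0#
  x+x≡0⇒x≡0 {x} x+x≡0 = x≢0⇒x*y≡0⇒y≡0 (0<x⇒x≢0 (+-nonneg-pos (inj₁ 0<1) 0<1)) (begin
    (1# + 1#) * x    ≡⟨ distribʳ x 1# 1# ⟩
    1# * x + 1# * x  ≡⟨ cong₂ _+_ (*-identityˡ x) (*-identityˡ x) ⟩
    x + x            ≡⟨ x+x≡0 ⟩
    0#               ∎)

  0<x⇒x+x≢0 : ∀ {x} → 0# < x → ¬ x + x ≡ 0#
  0<x⇒x+x≢0 0<x x+x≡0 = 0<x⇒x≢0 0<x (x+x≡0⇒x≡0 x+x≡0)

  f-nonneg : ∀ {t} → 0# ≤ t → f t ≡ t * t
  f-nonneg {t} 0≤t with compare t 0#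
  ... | tri≈ _ _ _ = refl
  ... | tri> _ _ _ = refl
  ... | tri< t<0 _ _ with 0≤t
  ...   | inj₁ 0<t = ⊥-elim (<-irrefl refl (<-trans t<0 0<t))
  ...   | inj₂ 0≡t = ⊥-elim (<-irrefl (sym 0≡t) t<0)

  f-nonpos : ∀ {t} → t ≤ 0# → f t ≡ - (t * t)
  f-nonpos {t} t≤0 with compare t 0#
  ... | tri< _ _ _ = refl
  ... | tri≈ _ t≡0 _ rewrite t≡0 = trans (zeroˡ 0#) (sym (trans (cong -_ (zeroˡ 0#)) -0#≈0#))
  ... | tri> _ _ 0<t with t≤0
  ...   | inj₁ t<0 = ⊥-elim (<-irrefl refl (<-trans t<0 0<t))
  ...   | inj₂ t≡0 = ⊥-elim (<-irrefl (sym t≡0) 0<t)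

  f-odd : ∀ t → f (- t) ≡ - f t
  f-odd t with <0⊎0≤ t
  ... | inj₁ t<0 = begin
    f (- t)        ≡⟨ f-nonneg (inj₁ (x<0⇒0<-x t<0)) ⟩
    - t * - t      ≡⟨ solve 1 (λ t → :- t :* :- t := :- (:- (t :* t))) refl t ⟩
    - - (t * t)    ≡⟨ cong -_ (f-nonpos (inj₁ t<0)) ⟨
    - f t          ∎
  ... | inj₂ 0≤t = begin
    f (- t)        ≡⟨ f-nonpos (0≤x⇒-x≤0 0≤t) ⟩
    - (- t * - t)  ≡⟨ solve 1 (λ t → :- (:- t :* :- t) := :- (t :* t)) refl t ⟩
    - (t * t)      ≡⟨ cong -_ (f-nonneg 0≤t) ⟨
    - f t          ∎

  Δ : ℝ → ℝ → ℝ
  Δ d s = f (s + d) - f s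

  data Position (d s : ℝ) : Set where
    left   : s < 0# → s + d ≤ 0# → Position d s
    across : s < 0# → 0# < s + d → Position d s
    right  : 0# ≤ s → Position d s

  position : ∀ d s → Position d s
  position d s with <0⊎0≤ s
  ... | inj₂ 0≤s = right 0≤s
  ... | inj₁ s<0 with <0⊎0≤ (s + d)
  ...   | inj₁ s+d<0        = left s<0 (inj₁ s+d<0)
  ...   | inj₂ (inj₂ 0≡s+d) = left s<0 (inj₂ (sym 0≡s+d))
  ...   | inj₂ (inj₁ 0<s+d) = across s<0 0<s+d

  Δ-left : ∀ {d s} → s < 0# → s + d ≤ 0# → Δ d s ≡ - (d * (s + s + d))
  Δ-left {d} {s} s<0 s+d≤0 = begin
    f (s + d) - f s                    ≡⟨ cong₂ _-_ (f-nonpos s+d≤0) (f-nonpos (inj₁ s<0)) ⟩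
    - ((s + d) * (s + d)) - - (s * s)  ≡⟨ solve 2 (λ d s → :- ((s :+ d) :* (s :+ d)) :- :- (s :* s)
                                                       := :- (d :* (s :+ s :+ d))) refl d s ⟩
    - (d * (s + s + d))                ∎

  Δ-across : ∀ {d s} → s < 0# → 0# < s + d → Δ d s ≡ s * s + (s + d) * (s + d)
  Δ-across {d} {s} s<0 0<s+d = begin
    f (s + d) - f s                    ≡⟨ cong₂ _-_ (f-nonneg (inj₁ 0<s+d)) (f-nonpos (inj₁ s<0)) ⟩
    (s + d) * (s + d) - - (s * s)      ≡⟨ solve 2 (λ d s → (s :+ d) :* (s :+ d) :- :- (s :* s)
                                                       := s :* s :+ (s :+ d) :* (s :+ d)) refl d s ⟩
    s * s + (s + d) * (s + d)          ∎

  Δ-right : ∀ {d s} → 0# < d → 0# ≤ s → Δ d s ≡ d * (s + s + d)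
  Δ-right {d} {s} 0<d 0≤s = begin
    f (s + d) - f s                    ≡⟨ cong₂ _-_ (f-nonneg (inj₁ (+-nonneg-pos 0≤s 0<d))) (f-nonneg 0≤s) ⟩
    (s + d) * (s + d) - s * s          ≡⟨ solve 2 (λ d s → (s :+ d) :* (s :+ d) :- s :* s
                                                       := d :* (s :+ s :+ d)) refl d s ⟩
    d * (s + s + d)                    ∎

  EqualOrMirrored : ℝ → ℝ → ℝ → Set
  EqualOrMirrored d s u = s ≡ u ⊎ s + u + d ≡ 0#

  EqualOrMirrored-sym : ∀ {d s u} → EqualOrMirrored d s u → EqualOrMirrored d u s
  EqualOrMirrored-sym (inj₁ s≡u)                 = inj₁ (sym s≡u)
  EqualOrMirrored-sym {d} {s} {u} (inj₂ s+u+d≡0) = inj₂ (trans (cong (_+ d) (+-comm u s)) s+u+d≡0)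

  twice-plus-injective : ∀ {d s u} → 0# < d → d * (s + s + d) ≡ d * (u + u + d) → s ≡ u
  twice-plus-injective {d} {s} {u} 0<d eq =
    x-y≡0⇒x≡y (x+x≡0⇒x≡0 (x≢0⇒x*y≡0⇒y≡0 (0<x⇒x≢0 0<d) (begin
      d * ((s - u) + (s - u))            ≡⟨ solve 3 (λ d s u → d :* ((s :- u) :+ (s :- u))
                                                       := d :* (s :+ s :+ d) :- d :* (u :+ u :+ d)) refl d s u ⟩
      d * (s + s + d) - d * (u + u + d)  ≡⟨ x≡y⇒x-y≡0 eq ⟩
      0#                                 ∎)))

  twice-plus-opposite : ∀ {d s u} → 0# < d → - (d * (s + s + d)) ≡ d * (u + u + d) →
                        s + u + d ≡ 0#
  twice-plus-opposite {d} {s} {u} 0<d eq =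
    x+x≡0⇒x≡0 (x≢0⇒x*y≡0⇒y≡0 (0<x⇒x≢0 0<d) (begin
      d * ((s + u + d) + (s + u + d))        ≡⟨ solve 3 (λ d s u → d :* ((s :+ u :+ d) :+ (s :+ u :+ d))
                                                           := d :* (u :+ u :+ d) :- :- (d :* (s :+ s :+ d)))
                                                           refl d s u ⟩
      d * (u + u + d) - - (d * (s + s + d))  ≡⟨ x≡y⇒x-y≡0 (sym eq) ⟩
      0#                                     ∎))

  squares-mirror : ∀ {d s u} → s * s + (s + d) * (s + d) ≡ u * u + (u + d) * (u + d) →
                   EqualOrMirrored d s u
  squares-mirror {d} {s} {u} eq with x*y≡0⇒x≡0⊎y≡0 (begin
      (s - u) * ((s + u + d) + (s + u + d))
        ≡⟨ solve 3 (λ d s u → (s :- u) :* ((s :+ u :+ d) :+ (s :+ u :+ d))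
                            := (s :* s :+ (s :+ d) :* (s :+ d)) :- (u :* u :+ (u :+ d) :* (u :+ d)))
                   refl d s u ⟩
      (s * s + (s + d) * (s + d)) - (u * u + (u + d) * (u + d))
        ≡⟨ x≡y⇒x-y≡0 eq ⟩
      0# ∎)
  ... | inj₁ s-u≡0             = inj₁ (x-y≡0⇒x≡y s-u≡0)
  ... | inj₂ [s+u+d]+[s+u+d]≡0 = inj₂ (x+x≡0⇒x≡0 [s+u+d]+[s+u+d]≡0)

  -- The difference of the two sides is twice a positive number.
  left≢across : ∀ {d s u} → 0# < d → s + d ≤ 0# → u < 0# → 0# < u + d →
                ¬ - (d * (s + s + d)) ≡ u * u + (u + d) * (u + d)
  left≢across {d} {s} {u} 0<d s+d≤0 u<0 0<u+d eq = 0<x⇒x+x≢0 0<w (begin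
      w + w
        ≡⟨ solve 3 (λ d s u → (:- (s :+ d) :* d :+ :- u :* (u :+ d))
                              :+ (:- (s :+ d) :* d :+ :- u :* (u :+ d))
                            := :- (d :* (s :+ s :+ d)) :- (u :* u :+ (u :+ d) :* (u :+ d)))
                   refl d s u ⟩
      - (d * (s + s + d)) - (u * u + (u + d) * (u + d))
        ≡⟨ x≡y⇒x-y≡0 eq ⟩
      0# ∎)
    where
    w = - (s + d) * d + - u * (u + d)
    0<w : 0# < w
    0<w = +-nonneg-pos (*-nonneg-pos (x≤0⇒0≤-x s+d≤0) 0<d) (*-pos (x<0⇒0<-x u<0) 0<u+d)

  right≢across : ∀ {d s u} → 0# < d → 0# ≤ s → u < 0# → 0# < u + d →
                 ¬ d * (s + s + d) ≡ u * u + (u + d) * (u + d)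
  right≢across {d} {s} {u} 0<d 0≤s u<0 0<u+d eq = 0<x⇒x+x≢0 0<w (begin
      w + w
        ≡⟨ solve 3 (λ d s u → (s :* d :+ :- u :* (u :+ d)) :+ (s :* d :+ :- u :* (u :+ d))
                            := d :* (s :+ s :+ d) :- (u :* u :+ (u :+ d) :* (u :+ d)))
                   refl d s u ⟩
      d * (s + s + d) - (u * u + (u + d) * (u + d))
        ≡⟨ x≡y⇒x-y≡0 eq ⟩
      0# ∎)
    where
    w = s * d + - u * (u + d)
    0<w : 0# < w
    0<w = +-nonneg-pos (*-nonneg-pos 0≤s 0<d) (*-pos (x<0⇒0<-x u<0) 0<u+d)

  Δ-injective-up-to-mirror : ∀ {d s u} → 0# < d → Δ d s ≡ Δ d u → EqualOrMirrored d s u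
  Δ-injective-up-to-mirror {d} {s} {u} 0<d Δs≡Δu = by-position (position d s) (position d u)
    where
    closed-forms : ∀ {a b} → Δ d s ≡ a → Δ d u ≡ b → a ≡ b
    closed-forms Δs≡a Δu≡b = subst₂ _≡_ Δs≡a Δu≡b Δs≡Δu

    by-position : Position d s → Position d u → EqualOrMirrored d s u
    by-position (left s<0 s+d≤0) (left u<0 u+d≤0) = inj₁ (twice-plus-injective 0<d
      (-‿injective (closed-forms (Δ-left s<0 s+d≤0) (Δ-left u<0 u+d≤0))))
    by-position (left s<0 s+d≤0) (across u<0 0<u+d) = ⊥-elim (left≢across 0<d s+d≤0 u<0 0<u+d
      (closed-forms (Δ-left s<0 s+d≤0) (Δ-across u<0 0<u+d)))
    by-position (left s<0 s+d≤0) (right 0≤u) = inj₂ (twice-plus-opposite 0<d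
      (closed-forms (Δ-left s<0 s+d≤0) (Δ-right 0<d 0≤u)))
    by-position (across s<0 0<s+d) (left u<0 u+d≤0) = ⊥-elim (left≢across 0<d u+d≤0 s<0 0<s+d
      (sym (closed-forms (Δ-across s<0 0<s+d) (Δ-left u<0 u+d≤0))))
    by-position (across s<0 0<s+d) (across u<0 0<u+d) = squares-mirror
      (closed-forms (Δ-across s<0 0<s+d) (Δ-across u<0 0<u+d))
    by-position (across s<0 0<s+d) (right 0≤u) = ⊥-elim (right≢across 0<d 0≤u s<0 0<s+d
      (sym (closed-forms (Δ-across s<0 0<s+d) (Δ-right 0<d 0≤u))))
    by-position (right 0≤s) (left u<0 u+d≤0) = EqualOrMirrored-sym (inj₂ (twice-plus-opposite 0<d
      (sym (closed-forms (Δ-right 0<d 0≤s) (Δ-left u<0 u+d≤0)))))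
    by-position (right 0≤s) (across u<0 0<u+d) = ⊥-elim (right≢across 0<d 0≤s u<0 0<u+d
      (closed-forms (Δ-right 0<d 0≤s) (Δ-across u<0 0<u+d)))
    by-position (right 0≤s) (right 0≤u) = inj₁ (twice-plus-injective 0<d
      (closed-forms (Δ-right 0<d 0≤s) (Δ-right 0<d 0≤u)))

  two-of-three-equal : ∀ {d s₁ s₂ s₃} → EqualOrMirrored d s₁ s₂ → EqualOrMirrored d s₁ s₃ →
                       s₁ ≡ s₂ ⊎ s₁ ≡ s₃ ⊎ s₂ ≡ s₃
  two-of-three-equal (inj₁ s₁≡s₂) _            = inj₁ s₁≡s₂
  two-of-three-equal (inj₂ _)     (inj₁ s₁≡s₃) = inj₂ (inj₁ s₁≡s₃)
  two-of-three-equal {d} {s₁} {s₂} {s₃} (inj₂ s₁+s₂+d≡0) (inj₂ s₁+s₃+d≡0) =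
    inj₂ (inj₂ (+-cancelˡ s₁ s₂ s₃ (+-cancelʳ d (s₁ + s₂) (s₁ + s₃)
      (trans s₁+s₂+d≡0 (sym s₁+s₃+d≡0)))))

  Translate-mono : ∀ {S T v p} → (∀ {q} → S q → T q) → Translate S v p → Translate T v p
  Translate-mono S⊆T (q , Sq , p≡q+v) = q , S⊆T Sq , p≡q+v

  AtMostTwo-mono : ∀ {A B : Point → Set} → (∀ {v} → A v → B v) → AtMostTwo B → AtMostTwo A
  AtMostTwo-mono A⊆B atMostTwo u v w Au Av Aw = atMostTwo u v w (A⊆B Au) (A⊆B Av) (A⊆B Aw)

  Translate-D-functional : ∀ {v P Q} → Translate D v P → Translate D v Q →
                           proj₁ P ≡ proj₁ Q → P ≡ Q
  Translate-D-functional {a , b} (_ , (t , refl) , refl) (_ , (s , refl) , refl) t+a≡s+a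
    with +-cancelʳ a t s t+a≡s+a
  ... | refl = refl

  translate-abscissa : ∀ {v P Q} → Translate D v P → Translate D v Q →
                       Σ ℝ λ s → v ≡ (proj₁ Q - s , proj₂ Q - f s)
                               × Δ (proj₁ P - proj₁ Q) s ≡ proj₂ P - proj₂ Q
  translate-abscissa {a , b} (_ , (t , refl) , refl) (_ , (s , refl) , refl) =
    s , cong₂ _,_ (x≡[y+x]-y a s) (x≡[y+x]-y b (f s)) , (begin
      f (s + ((t + a) - (s + a))) - f s
        ≡⟨ cong (λ x → f x - f s) (solve 3 (λ a s t → s :+ ((t :+ a) :- (s :+ a)) := t) refl a s t) ⟩
      f t - f s
        ≡⟨ solve 3 (λ b x y → x :- y := (x :+ b) :- (y :+ b)) refl b (f t) (f s) ⟩
      (f t + b) - (f s + b) ∎)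
    where
    x≡[y+x]-y : ∀ x y → x ≡ (y + x) - y
    x≡[y+x]-y = solve 2 (λ x y → x := (y :+ x) :- y) refl

  translates-separated : ∀ P Q → proj₁ Q < proj₁ P →
                         AtMostTwo (λ v → Translate D v P × Translate D v Q)
  translates-separated P Q q₁<p₁ v₁ v₂ v₃ (P₁ , Q₁) (P₂ , Q₂) (P₃ , Q₃)
    with translate-abscissa P₁ Q₁ | translate-abscissa P₂ Q₂ | translate-abscissa P₃ Q₃
  ... | s₁ , refl , Δs₁≡c | s₂ , refl , Δs₂≡c | s₃ , refl , Δs₃≡c =
    Sum.map (cong vertex) (Sum.map (cong vertex) (cong vertex))
      (two-of-three-equal (solutions-mirror Δs₁≡c Δs₂≡c) (solutions-mirror Δs₁≡c Δs₃≡c))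
    where
    d = proj₁ P - proj₁ Q

    vertex : ℝ → Point
    vertex s = (proj₁ Q - s , proj₂ Q - f s)

    solutions-mirror : ∀ {s u c} → Δ d s ≡ c → Δ d u ≡ c → EqualOrMirrored d s u
    solutions-mirror Δs≡c Δu≡c =
      Δ-injective-up-to-mirror (x<y⇒0<y-x q₁<p₁) (trans Δs≡c (sym Δu≡c))

  D-translates : ∀ P Q → ¬ P ≡ Q → AtMostTwo (λ v → Translate D v P × Translate D v Q)
  D-translates P Q P≢Q with compare (proj₁ Q) (proj₁ P)
  ... | tri< q₁<p₁ _ _ = translates-separated P Q q₁<p₁
  ... | tri> _ _ p₁<q₁ = AtMostTwo-mono swap (translates-separated Q P p₁<q₁)
  ... | tri≈ _ q₁≡p₁ _ = λ _ _ _ (onP , onQ) _ _ →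
    ⊥-elim (P≢Q (Translate-D-functional onP onQ (sym q₁≡p₁)))

  negD⊆D : ∀ {p} → negD p → D p
  negD⊆D (_ , (t , refl) , refl) = - t , cong (- t ,_) (sym (f-odd t))

  negD-translates : ∀ P Q → ¬ P ≡ Q → AtMostTwo (λ v → Translate negD v P × Translate negD v Q)
  negD-translates P Q P≢Q =
    AtMostTwo-mono (Product.map (Translate-mono negD⊆D) (Translate-mono negD⊆D))
      (D-translates P Q P≢Q)

mainTheorem15 : (R : Reals) → let open RealDefs R in
    (∀ (P Q : Point) → ¬ (P ≡ Q) →
    AtMostTwo (λ v → Translate D v P × Translate D v Q))
    × (∀ (P Q : Point) → ¬ (P ≡ Q) →
    AtMostTwo (λ v → Translate negD v P × Translate negD v Q))
mainTheorem15 R = D-translates , negD-translates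
  where open TranslatesOfD R
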